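{- Let $a$ be an integer and $n$ an integer with $\gcd(n,2a)=1$. Then $n$ is a strong Frobenius pseudoprime with respect to $x-a$ if and only if $n$ is a strong pseudoprime to the base $a$.
   Context: A strong pseudoprime to the base $a$ is an odd composite $n=2^rs+1$ with $s$ odd such that either $a^s\equiv 1\pmod n$ or $a^{2^ts}\equiv -1\pmod n$ for some integer $t$ with $0\le t<r$. For monic polynomials $g_1,g_2$ over a commutative ring $R$ with identity, a monic $h\in R[x]$ is $\operatorname{gcmd}(g_1,g_2)$ if the ideal generated by $g_1,g_2$ equals the ideal generated by $h$ (it may fail to exist). Let $f(x)\in\mathbb{Z}[x]$ be monic of degree $d$ with discriminant $\Delta$. An odd integer $n>1$ is a Frobenius probable prime with respect to $f$ if $\gcd(n,f(0)\Delta)=1$ and, with all computations in $(\mathbb{Z}/n\mathbb{Z})[x]$: (Factorization) setting $f_0=f\bmod n$ and, for $1\le i\le d$, $F_i=\operatorname{gcmd}(x^{n^i}-x,f_{i-1})$ and $f_i=f_{i-1}/F_i$, all these gcmds exist and $f_d=1$; (Frobenius) for $2\le i\le d$, $F_i(x^n)\equiv 0\pmod{F_i(x)}$; (Jacobi) with $S=\sum_{2\mid i}\deg(F_i)/i$, one has $(-1)^S=\left(\frac{\Delta}{n}\right)$ (Jacobi symbol). $n$ is a strong Frobenius probable prime with respect to $f$ if it is a Frobenius probable prime and moreover (Square Root Step) for each $1\le i\le d$, writing $n^i-1=2^rs$ with $s$ odd, the polynomials $F_{i,0}=\operatorname{gcmd}(F_i,x^s-1)$ and $F_{i,j}=\operatorname{gcmd}(F_i,x^{2^{j-1}s}+1)$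 for $1\le j\le r$ all exist, $F_i=\prod_{j=0}^rF_{i,j}$, and each $\deg F_{i,j}$ is a multiple of $i$. A strong Frobenius pseudoprime with respect to $f$ is a composite strong Frobenius probable prime with respect to $f$. -}

module Defs where

open import Data.Nat as ℕ using (ℕ; zero; suc; _∸_; _<_; _≤_; _<ᵇ_; _≡ᵇ_)
open import Data.Nat.Divisibility as ℕD using ()
open import Data.Nat.GCD using (gcd)
open import Data.Nat.Primality using (Prime; Composite)
open import Data.Integer as ℤ using (ℤ; +_; -[1+_])
open import Data.Integer.Divisibility.Signed using (_∣_; _∣?_)
open import Data.Fin using (Fin; toℕ; punchIn)
import Data.Fin as Fin
open import Data.Fin.Properties using (any?)
open import Data.List using (List; []; _∷_; length; foldr; replicate; _++_)
open import Data.Nat.ListAction using (product)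
open import Data.List.Relation.Unary.All using (All)
open import Data.Bool using (Bool; if_then_else_)
open import Data.Product using (Σ; ∃; ∃₂; _×_)
open import Data.Sum using (_⊎_)
open import Relation.Nullary.Decidable using (does)
open import Relation.Binary.PropositionalEquality using (_≡_)

-- Polynomials with integer coefficients, as coefficient lists
-- (lowest degree first).  Polynomials over ℤ/nℤ are represented by
-- integer polynomials, compared with the congruence _≈[_]_ below.

Poly : Set
Poly = List ℤ

coeff : Poly → ℕ → ℤ
coeff []      _       = + 0
coeff (c ∷ p) zero    = c
coeff (c ∷ p) (suc k) = coeff p k

coeffℤ : Poly → ℤ → ℤ
coeffℤ p (+ k)    = coeff p k
coeffℤ p -[1+ _ ] = + 0

-- formal degree of a (normalised) coefficient list
deg : Poly → ℕ
deg p = length p ∸ 1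

infixl 6 _⊕_
infixl 7 _⊛_

_⊕_ : Poly → Poly → Poly
[]      ⊕ q       = q
(c ∷ p) ⊕ []      = c ∷ p
(c ∷ p) ⊕ (e ∷ q) = (c ℤ.+ e) ∷ (p ⊕ q)

scale : ℤ → Poly → Poly
scale c []      = []
scale c (e ∷ q) = (c ℤ.* e) ∷ scale c q

negP : Poly → Poly
negP = scale (ℤ.- (+ 1))

_⊛_ : Poly → Poly → Poly
[]      ⊛ q = []
(c ∷ p) ⊛ q = scale c q ⊕ (+ 0 ∷ (p ⊛ q))

one : Poly
one = + 1 ∷ []

X^ : ℕ → Poly
X^ m = replicate m (+ 0) ++ (+ 1 ∷ [])

compose : Poly → Poly → Poly
compose p q = foldr (λ c acc → (c ∷ []) ⊕ (q ⊛ acc)) [] p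

deriv : Poly → Poly
deriv []      = []
deriv (_ ∷ p) = go 1 p
  where
  go : ℕ → Poly → Poly
  go k []      = []
  go k (c ∷ q) = ((+ k) ℤ.* c) ∷ go (suc k) q

_≈[_]_ : Poly → ℕ → Poly → Set
p ≈[ n ] q = ∀ k → (+ n) ∣ (coeff p k ℤ.- coeff q k)

MonicDeg : ℕ → ℕ → Poly → Set
MonicDeg n d p = ((+ n) ∣ (coeff p d ℤ.- + 1)) × (∀ k → d < k → (+ n) ∣ coeff p k)

-- h = gcmd(g₁, g₂) in (ℤ/nℤ)[x], and h has degree dh:
-- h is monic and the ideals (g₁, g₂) and (h) coincide.
IsGcmd : ℕ → Poly → Poly → Poly → ℕ → Set
IsGcmd n g₁ g₂ h dh =
  MonicDeg n dh h
  × (∃₂ λ u v → h ≈[ n ] (u ⊛ g₁ ⊕ v ⊛ g₂))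
  × (∃ λ p → g₁ ≈[ n ] (p ⊛ h))
  × (∃ λ q → g₂ ≈[ n ] (q ⊛ h))

negPow : ℕ → ℤ
negPow zero    = + 1
negPow (suc k) = ℤ.- negPow k

sumFin : ∀ {k} → (Fin k → ℤ) → ℤ
sumFin {zero}  f = + 0
sumFin {suc k} f = f Fin.zero ℤ.+ sumFin (λ j → f (Fin.suc j))

det : ∀ k → (Fin k → Fin k → ℤ) → ℤ
det zero    M = + 1
det (suc k) M =
  sumFin (λ j → negPow (toℕ j) ℤ.* M Fin.zero j ℤ.* det k (λ r c → M (Fin.suc r) (punchIn j c)))

-- Sylvester matrix of p (degree m) and q (degree k): k rows of
-- coefficients of p, then m rows of coefficients of q.
sylvester : (m k : ℕ) → Poly → Poly → Fin (m ℕ.+ k) → Fin (m ℕ.+ k) → ℤ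
sylvester m k p q r c =
  if toℕ r <ᵇ k
  then coeffℤ p ((+ (m ℕ.+ toℕ r)) ℤ.- (+ toℕ c))
  else coeffℤ q ((+ (k ℕ.+ (toℕ r ∸ k))) ℤ.- (+ toℕ c))

resultant : Poly → Poly → ℤ
resultant p q = det (deg p ℕ.+ deg q) (sylvester (deg p) (deg q) p q)

-- discriminant of a monic f of degree d: (-1)^(d(d-1)/2) Res(f, f')
disc : Poly → ℤ
disc f = negPow ((deg f ℕ.* (deg f ∸ 1)) ℕ./ 2) ℤ.* resultant f (deriv f)

legendre : ℤ → ℕ → ℤ
legendre a p =
  if does ((+ p) ∣? a) then + 0
  else if does (any? {n = p} (λ (x : Fin p) → (+ p) ∣? ((+ toℕ x) ℤ.* (+ toℕ x) ℤ.- a)))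
       then + 1 else ℤ.- (+ 1)

-- (a / n) = j : product of Legendre symbols over a prime factorisation of n
JacobiIs : ℤ → ℕ → ℤ → Set
JacobiIs a n j =
  ∃ λ (ps : List ℕ) → All Prime ps × product ps ≡ n
                     × foldr (λ p acc → legendre a p ℤ.* acc) (+ 1) ps ≡ j

Odd : ℕ → Set
Odd n = n ℕ.% 2 ≡ 1

Ssum : (ℕ → ℕ) → ℕ → ℕ
Ssum dF zero    = 0
Ssum dF (suc i) =
  Ssum dF i ℕ.+ (if (suc i ℕ.% 2) ≡ᵇ 0 then dF (suc i) ℕ./ suc i else 0)

prodPoly : (ℕ → Poly) → ℕ → Poly
prodPoly G zero    = G 0
prodPoly G (suc j) = prodPoly G j ⊛ G (suc j)

record Factorization (n : ℕ) (f : Poly) : Set where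
  field
    F     : ℕ → Poly
    dF    : ℕ → ℕ
    fs    : ℕ → Poly
    fs0   : fs 0 ≡ f
    gcmdF : ∀ i → 1 ≤ i → i ≤ deg f →
              IsGcmd n (X^ (n ℕ.^ i) ⊕ negP (X^ 1)) (fs (i ∸ 1)) (F i) (dF i)
    quotF : ∀ i → 1 ≤ i → i ≤ deg f → fs (i ∸ 1) ≈[ n ] (fs i ⊛ F i)
    lastF : fs (deg f) ≈[ n ] one

open Factorization public

FrobeniusStep : (n : ℕ) (f : Poly) → Factorization n f → Set
FrobeniusStep n f fac =
  ∀ i → 2 ≤ i → i ≤ deg f → ∃ λ q → compose (F fac i) (X^ n) ≈[ n ] (q ⊛ F fac i)

JacobiStep : (n : ℕ) (f : Poly) → Factorization n f → Set
JacobiStep n f fac = JacobiIs (disc f) n (negPow (Ssum (dF fac) (deg f)))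

SquareRootStep : (n : ℕ) (f : Poly) → Factorization n f → Set
SquareRootStep n f fac =
  ∀ i → 1 ≤ i → i ≤ deg f →
    ∃₂ λ r s → (n ℕ.^ i ∸ 1 ≡ 2 ℕ.^ r ℕ.* s) × Odd s ×
      Σ (ℕ → Poly) λ G → Σ (ℕ → ℕ) λ dG →
        IsGcmd n (F fac i) (X^ s ⊕ negP one) (G 0) (dG 0)
        × (∀ j → 1 ≤ j → j ≤ r →
             IsGcmd n (F fac i) (X^ (2 ℕ.^ (j ∸ 1) ℕ.* s) ⊕ one) (G j) (dG j))
        × (F fac i ≈[ n ] prodPoly G r)
        × (∀ j → j ≤ r → i ℕD.∣ dG j)

BasicConditions : ℕ → Poly → Set
BasicConditions n f =
  Odd n × 1 < n × gcd n (ℤ.∣ coeff f 0 ℤ.* disc f ∣) ≡ 1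

FrobeniusProbablePrime : ℕ → Poly → Set
FrobeniusProbablePrime n f =
  BasicConditions n f ×
  Σ (Factorization n f) λ fac → FrobeniusStep n f fac × JacobiStep n f fac

StrongFrobeniusProbablePrime : ℕ → Poly → Set
StrongFrobeniusProbablePrime n f =
  BasicConditions n f ×
  Σ (Factorization n f) λ fac →
    FrobeniusStep n f fac × JacobiStep n f fac × SquareRootStep n f fac

StrongFrobeniusPseudoprime : ℕ → Poly → Set
StrongFrobeniusPseudoprime n f = Composite n × StrongFrobeniusProbablePrime n f

StrongPseudoprime : ℤ → ℕ → Set
StrongPseudoprime a n =
  Odd n × Composite n ×
  ∃₂ λ r s → (n ≡ 2 ℕ.^ r ℕ.* s ℕ.+ 1) × Odd s ×
    (((+ n) ∣ (a ℤ.^ s ℤ.- + 1))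
     ⊎ ∃ λ t → t < r × (+ n) ∣ (a ℤ.^ (2 ℕ.^ t ℕ.* s) ℤ.+ + 1))

X-minus : ℤ → Poly
X-minus a = ℤ.- a ∷ + 1 ∷ []

-- Evaluation at a identifies (ℤ/n)[x]/(x - a) with ℤ/n: gcmd(x - a, g) is x - a when g(a) ≡ 0
-- and 1 when g(a) is a unit, and a monic divisor of x - a of positive degree has a as a root.
-- The Factorization step forces F₁ ≡ x - a, and the square root step writes it as the product
-- of its gcmds G_j with x^s - 1 and x^(2^(j-1) s) + 1 (j ≤ r).  If every G_j had degree 0 the
-- product would be 1 at a, so some G_j, and with it the polynomial it divides, vanishes at a:
-- this is the strong pseudoprime condition.  Conversely, if the i-th polynomial vanishes at a,
-- the values of the others are units modulo the odd n (below i they divide a^(2^t s) - 1 ≡ -2,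
-- above i they are ≡ 2), so G = x - a at index i and 1 elsewhere works, and the resulting
-- a^(n-1) ≡ 1 gives the factorization step.

module Submission where

open import Defs
open import Data.Nat using (ℕ)
open import Data.Nat.GCD using (gcd)
open import Data.Integer as ℤ using (ℤ; +_)
open import Function.Bundles using (_⇔_)
open import Relation.Binary.PropositionalEquality using (_≡_)

import Data.Nat as ℕ
open import Data.Nat using (zero; suc; _≤_; _<_; z≤n; s≤s; _∸_; nonTrivial⇒n>1)
import Data.Nat.Properties as ℕP
import Data.Nat.Divisibility as ℕD
open import Data.Nat.Coprimality using (coprime⇒gcd≡1; gcd≡1⇒coprime)
open import Data.Nat.DivMod using (m≡m%n+[m/n]*n)
open import Data.Nat.Primality using (Prime; composite⇒nonTrivial; composite⇒nonZero; prime⇒nonTrivial)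
open import Data.Nat.Primality.Factorisation using (factorise; PrimeFactorisation)
open import Data.Integer using (_+_; _*_; _-_; -_; _^_)
import Data.Integer.Properties as ℤP
open import Data.Integer.Divisibility.Signed
open import Data.Integer.Tactic.RingSolver using (solve-∀)
open import Data.Fin using (Fin; toℕ; fromℕ<)
open import Data.Fin.Properties using (any?; toℕ-fromℕ<)
open import Data.List using ([]; _∷_; drop; foldr)
open import Data.List.Relation.Unary.All using (All; []; _∷_)
open import Data.Product using (∃; _×_; _,_; proj₁; proj₂)
open import Data.Sum using (_⊎_; inj₁; inj₂)
open import Data.Empty using (⊥-elim)
open import Function.Base using (_∘_)
open import Function.Bundles using (mk⇔)
open import Relation.Nullary using (¬_; yes; no)
open import Relation.Nullary.Decidable using (dec-true; dec-false)
open import Relation.Binary.Bundles using (Setoid)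
open import Relation.Binary.Definitions using (tri<; tri≈; tri>)
open import Relation.Binary.PropositionalEquality
  using (_≢_; refl; sym; trans; cong; cong₂; subst; subst₂; module ≡-Reasoning)
import Relation.Binary.Reasoning.Setoid as SetoidReasoning

infix 4 _≡_mod_

-- A record rather than the bare + n ∣ x - y, so that x and y can be inferred from a proof
-- (the difference x - y does not determine them).
record _≡_mod_ (x y : ℤ) (n : ℕ) : Set where
  constructor mk≡mod
  field ∣diff : + n ∣ x - y

open _≡_mod_ public

module _ {n : ℕ} where

  ≡-mod-reflexive : ∀ {x y} → x ≡ y → x ≡ y mod n
  ≡-mod-reflexive {x} refl = mk≡mod (divides (+ 0) (ℤP.+-inverseʳ x))

  ≡-mod-refl : ∀ {x} → x ≡ x mod n
  ≡-mod-refl = ≡-mod-reflexive refl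

  ≡-mod-sym : ∀ {x y} → x ≡ y mod n → y ≡ x mod n
  ≡-mod-sym {x} {y} (mk≡mod n∣x-y) = mk≡mod (subst (+ n ∣_) (negate x y) (∣m⇒∣-m n∣x-y))
    where
    negate : ∀ x y → - (x - y) ≡ y - x
    negate = solve-∀

  ≡-mod-trans : ∀ {x y z} → x ≡ y mod n → y ≡ z mod n → x ≡ z mod n
  ≡-mod-trans {x} {y} {z} (mk≡mod n∣x-y) (mk≡mod n∣y-z) =
    mk≡mod (subst (+ n ∣_) (telescope x y z) (∣m∣n⇒∣m+n n∣x-y n∣y-z))
    where
    telescope : ∀ x y z → (x - y) + (y - z) ≡ x - z
    telescope = solve-∀

  +-cong-mod : ∀ {x x' y y'} → x ≡ x' mod n → y ≡ y' mod n → x + y ≡ x' + y' mod n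
  +-cong-mod {x} {x'} {y} {y'} (mk≡mod n∣x-x') (mk≡mod n∣y-y') =
    mk≡mod (subst (+ n ∣_) (regroup x x' y y') (∣m∣n⇒∣m+n n∣x-x' n∣y-y'))
    where
    regroup : ∀ x x' y y' → (x - x') + (y - y') ≡ (x + y) - (x' + y')
    regroup = solve-∀

  *-cong-mod : ∀ {x x' y y'} → x ≡ x' mod n → y ≡ y' mod n → x * y ≡ x' * y' mod n
  *-cong-mod {x} {x'} {y} {y'} (mk≡mod n∣x-x') (mk≡mod n∣y-y') =
    mk≡mod (subst (+ n ∣_) (regroup x x' y y') (∣m∣n⇒∣m+n (∣m⇒∣m*n y n∣x-x') (∣n⇒∣m*n x' n∣y-y')))
    where
    regroup : ∀ x x' y y' → (x - x') * y + x' * (y - y') ≡ x * y - x' * y'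
    regroup = solve-∀

  +-congˡ-mod : ∀ x {y y'} → y ≡ y' mod n → x + y ≡ x + y' mod n
  +-congˡ-mod x = +-cong-mod (≡-mod-refl {x})

  +-congʳ-mod : ∀ {x x'} y → x ≡ x' mod n → x + y ≡ x' + y mod n
  +-congʳ-mod y x≡x' = +-cong-mod x≡x' (≡-mod-refl {y})

  *-congˡ-mod : ∀ x {y y'} → y ≡ y' mod n → x * y ≡ x * y' mod n
  *-congˡ-mod x = *-cong-mod (≡-mod-refl {x})

  *-congʳ-mod : ∀ {x x'} y → x ≡ x' mod n → x * y ≡ x' * y mod n
  *-congʳ-mod y x≡x' = *-cong-mod x≡x' (≡-mod-refl {y})

  ∣⇒≡0-mod : ∀ {x} → + n ∣ x → x ≡ + 0 mod n
  ∣⇒≡0-mod {x} n∣x = mk≡mod (subst (+ n ∣_) (sym (ℤP.+-identityʳ x)) n∣x)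

  ≡0-mod⇒∣ : ∀ {x} → x ≡ + 0 mod n → + n ∣ x
  ≡0-mod⇒∣ {x} (mk≡mod n∣x-0) = subst (+ n ∣_) (ℤP.+-identityʳ x) n∣x-0

1≢0-mod : ∀ {n} → 1 < n → ¬ (+ 1 ≡ + 0 mod n)
1≢0-mod 1<n (mk≡mod n∣1) = ℕP.<⇒≢ 1<n (sym (ℕD.∣1⇒≡1 (∣⇒∣ᵤ n∣1)))

≡-mod-setoid : ℕ → Setoid _ _
≡-mod-setoid n = record
  { Carrier = ℤ
  ; _≈_ = λ x y → x ≡ y mod n
  ; isEquivalence = record { refl = ≡-mod-refl ; sym = ≡-mod-sym ; trans = ≡-mod-trans }
  }

module ≡-mod-Reasoning (n : ℕ) = SetoidReasoning (≡-mod-setoid n)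

Unit : ℕ → ℤ → Set
Unit n x = ∃ λ w → w * x ≡ + 1 mod n

module _ {n : ℕ} where

  unit-resp : ∀ {x y} → x ≡ y mod n → Unit n x → Unit n y
  unit-resp x≡y (w , w*x≡1) = w , ≡-mod-trans (*-congˡ-mod w (≡-mod-sym x≡y)) w*x≡1

  unit-∣ : ∀ {d x} → d ∣ x → Unit n x → Unit n d
  unit-∣ {d} {x} (divides q x≡q*d) (w , w*x≡1) = w * q , (begin
    w * q * d    ≡⟨ ℤP.*-assoc w q d ⟩
    w * (q * d)  ≡⟨ cong (w *_) x≡q*d ⟨
    w * x        ≈⟨ w*x≡1 ⟩
    + 1          ∎)
    where open ≡-mod-Reasoning n

  unit-neg : ∀ {x} → Unit n x → Unit n (- x)
  unit-neg {x} (w , w*x≡1) = - w , ≡-mod-trans (≡-mod-reflexive (neg*neg w x)) w*x≡1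
    where
    neg*neg : ∀ w x → - w * - x ≡ w * x
    neg*neg = solve-∀

  two-unit : Odd n → Unit n (+ 2)
  two-unit odd = + q + + 1 , mk≡mod (divides (+ 1) (begin
    (+ q + + 1) * + 2 - + 1  ≡⟨ double (+ q) ⟩
    + 1 + + q * + 2          ≡⟨ cong (_+_ (+ 1)) (ℤP.pos-* q 2) ⟨
    + 1 + + (q ℕ.* 2)        ≡⟨ cong +_ n≡1+q*2 ⟨
    + n                      ≡⟨ ℤP.*-identityˡ (+ n) ⟨
    + 1 * + n                ∎))
    where
    open ≡-Reasoning
    q = n ℕ./ 2
    n≡1+q*2 : n ≡ 1 ℕ.+ q ℕ.* 2
    n≡1+q*2 = trans (m≡m%n+[m/n]*n n 2) (cong (ℕ._+ q ℕ.* 2) odd)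
    double : ∀ x → (x + + 1) * + 2 - + 1 ≡ + 1 + x * + 2
    double = solve-∀

coeff-⊕ : ∀ p q k → coeff (p ⊕ q) k ≡ coeff p k + coeff q k
coeff-⊕ []      q       k       = sym (ℤP.+-identityˡ _)
coeff-⊕ (c ∷ p) []      k       = sym (ℤP.+-identityʳ _)
coeff-⊕ (c ∷ p) (e ∷ q) zero    = refl
coeff-⊕ (c ∷ p) (e ∷ q) (suc k) = coeff-⊕ p q k

⊕-identityʳ : ∀ p → p ⊕ [] ≡ p
⊕-identityʳ []      = refl
⊕-identityʳ (c ∷ p) = refl

coeff-scale : ∀ c p k → coeff (scale c p) k ≡ c * coeff p k
coeff-scale c []      k       = sym (ℤP.*-zeroʳ c)
coeff-scale c (e ∷ p) zero    = refl
coeff-scale c (e ∷ p) (suc k) = coeff-scale c p k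

coeff-⊛-zero : ∀ p q → coeff (p ⊛ q) 0 ≡ coeff p 0 * coeff q 0
coeff-⊛-zero []      q = refl
coeff-⊛-zero (c ∷ p) q = begin
  coeff ((c ∷ p) ⊛ q) 0     ≡⟨ coeff-⊕ (scale c q) _ 0 ⟩
  coeff (scale c q) 0 + + 0 ≡⟨ ℤP.+-identityʳ _ ⟩
  coeff (scale c q) 0       ≡⟨ coeff-scale c q 0 ⟩
  c * coeff q 0             ∎
  where open ≡-Reasoning

coeff-⊛-suc : ∀ p q k →
  coeff (p ⊛ q) (suc k) ≡ coeff p 0 * coeff q (suc k) + coeff (drop 1 p ⊛ q) k
coeff-⊛-suc []      q k = refl
coeff-⊛-suc (c ∷ p) q k =
  trans (coeff-⊕ (scale c q) _ (suc k)) (cong (_+ coeff (p ⊛ q) k) (coeff-scale c q (suc k)))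

coeff-drop-1 : ∀ p k → coeff (drop 1 p) k ≡ coeff p (suc k)
coeff-drop-1 []      k = refl
coeff-drop-1 (c ∷ p) k = refl

coeff-const-⊛ : ∀ c q k → coeff ((c ∷ []) ⊛ q) k ≡ c * coeff q k
coeff-const-⊛ c q zero    = coeff-⊛-zero (c ∷ []) q
coeff-const-⊛ c q (suc k) = trans (coeff-⊛-suc (c ∷ []) q k) (ℤP.+-identityʳ _)

coeff-scale-⊛ : ∀ c p q k → coeff (scale c p ⊛ q) k ≡ c * coeff (p ⊛ q) k
coeff-scale-⊛ c []      q k       = sym (ℤP.*-zeroʳ c)
coeff-scale-⊛ c (e ∷ p) q zero    = begin
  coeff (scale c (e ∷ p) ⊛ q) 0 ≡⟨ coeff-⊛-zero (scale c (e ∷ p)) q ⟩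
  c * e * coeff q 0             ≡⟨ ℤP.*-assoc c e _ ⟩
  c * (e * coeff q 0)           ≡⟨ cong (c *_) (coeff-⊛-zero (e ∷ p) q) ⟨
  c * coeff ((e ∷ p) ⊛ q) 0     ∎
  where open ≡-Reasoning
coeff-scale-⊛ c (e ∷ p) q (suc k) = begin
  coeff (scale c (e ∷ p) ⊛ q) (suc k)
    ≡⟨ coeff-⊛-suc (scale c (e ∷ p)) q k ⟩
  c * e * coeff q (suc k) + coeff (scale c p ⊛ q) k
    ≡⟨ cong₂ _+_ (ℤP.*-assoc c e _) (coeff-scale-⊛ c p q k) ⟩
  c * (e * coeff q (suc k)) + c * coeff (p ⊛ q) k
    ≡⟨ ℤP.*-distribˡ-+ c _ _ ⟨
  c * (e * coeff q (suc k) + coeff (p ⊛ q) k)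
    ≡⟨ cong (c *_) (coeff-⊛-suc (e ∷ p) q k) ⟨
  c * coeff ((e ∷ p) ⊛ q) (suc k) ∎
  where open ≡-Reasoning

coeff-⊛-one : ∀ p k → coeff (p ⊛ one) k ≡ coeff p k
coeff-⊛-one p zero    = trans (coeff-⊛-zero p one) (ℤP.*-identityʳ _)
coeff-⊛-one p (suc k) = begin
  coeff (p ⊛ one) (suc k)                        ≡⟨ coeff-⊛-suc p one k ⟩
  coeff p 0 * + 0 + coeff (drop 1 p ⊛ one) k     ≡⟨ cong₂ _+_ (ℤP.*-zeroʳ (coeff p 0)) (coeff-⊛-one (drop 1 p) k) ⟩
  + 0 + coeff (drop 1 p) k                       ≡⟨ ℤP.+-identityˡ _ ⟩
  coeff (drop 1 p) k                             ≡⟨ coeff-drop-1 p k ⟩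
  coeff p (suc k)                                ∎
  where open ≡-Reasoning

infix 4 _≋_mod_

-- A record for the same reason as _≡_mod_.
record _≋_mod_ (p q : Poly) (n : ℕ) : Set where
  constructor coeffwise
  field coeff-≡ : ∀ k → coeff p k ≡ coeff q k mod n

open _≋_mod_ public

module _ {n : ℕ} where

  ≋⇒≈ : ∀ {p q} → p ≋ q mod n → p ≈[ n ] q
  ≋⇒≈ p≋q k = ∣diff (coeff-≡ p≋q k)

  ≈⇒≋ : ∀ {p q} → p ≈[ n ] q → p ≋ q mod n
  ≈⇒≋ p≈q = coeffwise λ k → mk≡mod (p≈q k)

  ≋-reflexive : ∀ {p q} → (∀ k → coeff p k ≡ coeff q k) → p ≋ q mod n
  ≋-reflexive eq = coeffwise λ k → ≡-mod-reflexive (eq k)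

  ≋-refl : ∀ {p} → p ≋ p mod n
  ≋-refl = ≋-reflexive λ _ → refl

  ≋-sym : ∀ {p q} → p ≋ q mod n → q ≋ p mod n
  ≋-sym p≋q = coeffwise λ k → ≡-mod-sym (coeff-≡ p≋q k)

  ≋-trans : ∀ {p q r} → p ≋ q mod n → q ≋ r mod n → p ≋ r mod n
  ≋-trans p≋q q≋r = coeffwise λ k → ≡-mod-trans (coeff-≡ p≋q k) (coeff-≡ q≋r k)

≋-setoid : ℕ → Setoid _ _
≋-setoid n = record
  { Carrier = Poly
  ; _≈_ = λ p q → p ≋ q mod n
  ; isEquivalence = record { refl = ≋-refl ; sym = ≋-sym ; trans = ≋-trans }
  }

module ≋-Reasoning (n : ℕ) = SetoidReasoning (≋-setoid n)

module _ {n : ℕ} where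

  ⊛-congʳ : ∀ {p p'} q → p ≋ p' mod n → p ⊛ q ≋ p' ⊛ q mod n
  ⊛-congʳ q p≋p' = coeffwise (go p≋p')
    where
    drop-1-cong : ∀ {p p'} → p ≋ p' mod n → drop 1 p ≋ drop 1 p' mod n
    drop-1-cong {p} {p'} p≋p' = coeffwise λ k → begin
      coeff (drop 1 p) k  ≡⟨ coeff-drop-1 p k ⟩
      coeff p (suc k)     ≈⟨ coeff-≡ p≋p' (suc k) ⟩
      coeff p' (suc k)    ≡⟨ coeff-drop-1 p' k ⟨
      coeff (drop 1 p') k ∎
      where open ≡-mod-Reasoning n
    go : ∀ {p p'} → p ≋ p' mod n → ∀ k → coeff (p ⊛ q) k ≡ coeff (p' ⊛ q) k mod n
    go {p} {p'} p≋p' zero = begin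
      coeff (p ⊛ q) 0          ≡⟨ coeff-⊛-zero p q ⟩
      coeff p 0 * coeff q 0    ≈⟨ *-congʳ-mod (coeff q 0) (coeff-≡ p≋p' 0) ⟩
      coeff p' 0 * coeff q 0   ≡⟨ coeff-⊛-zero p' q ⟨
      coeff (p' ⊛ q) 0         ∎
      where open ≡-mod-Reasoning n
    go {p} {p'} p≋p' (suc k) = begin
      coeff (p ⊛ q) (suc k)
        ≡⟨ coeff-⊛-suc p q k ⟩
      coeff p 0 * coeff q (suc k) + coeff (drop 1 p ⊛ q) k
        ≈⟨ +-cong-mod (*-congʳ-mod (coeff q (suc k)) (coeff-≡ p≋p' 0)) (go (drop-1-cong p≋p') k) ⟩
      coeff p' 0 * coeff q (suc k) + coeff (drop 1 p' ⊛ q) k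
        ≡⟨ coeff-⊛-suc p' q k ⟨
      coeff (p' ⊛ q) (suc k) ∎
      where open ≡-mod-Reasoning n

  ⊛-identityˡ : ∀ p → one ⊛ p ≋ p mod n
  ⊛-identityˡ p = ≋-reflexive λ k → trans (coeff-const-⊛ (+ 1) p k) (ℤP.*-identityˡ _)

  ⊛-identityʳ : ∀ p → p ⊛ one ≋ p mod n
  ⊛-identityʳ p = ≋-reflexive (coeff-⊛-one p)

  ⊕-comm : ∀ p q → p ⊕ q ≋ q ⊕ p mod n
  ⊕-comm p q = ≋-reflexive λ k → begin
    coeff (p ⊕ q) k       ≡⟨ coeff-⊕ p q k ⟩
    coeff p k + coeff q k ≡⟨ ℤP.+-comm (coeff p k) _ ⟩
    coeff q k + coeff p k ≡⟨ coeff-⊕ q p k ⟨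
    coeff (q ⊕ p) k       ∎
    where open ≡-Reasoning

ev : ℤ → Poly → ℤ
ev a []      = + 0
ev a (c ∷ p) = c + a * ev a p

ev-⊕ : ∀ a p q → ev a (p ⊕ q) ≡ ev a p + ev a q
ev-⊕ a []      q       = sym (ℤP.+-identityˡ _)
ev-⊕ a (c ∷ p) []      = sym (ℤP.+-identityʳ _)
ev-⊕ a (c ∷ p) (e ∷ q) = begin
  c + e + a * ev a (p ⊕ q)          ≡⟨ cong (λ t → c + e + a * t) (ev-⊕ a p q) ⟩
  c + e + a * (ev a p + ev a q)     ≡⟨ regroup a c e (ev a p) (ev a q) ⟩
  c + a * ev a p + (e + a * ev a q) ∎
  where
  open ≡-Reasoning
  regroup : ∀ a c e x y → c + e + a * (x + y) ≡ c + a * x + (e + a * y)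
  regroup = solve-∀

ev-scale : ∀ a c p → ev a (scale c p) ≡ c * ev a p
ev-scale a c []      = sym (ℤP.*-zeroʳ c)
ev-scale a c (e ∷ p) = begin
  c * e + a * ev a (scale c p) ≡⟨ cong (λ t → c * e + a * t) (ev-scale a c p) ⟩
  c * e + a * (c * ev a p)     ≡⟨ regroup a c e (ev a p) ⟩
  c * (e + a * ev a p)         ∎
  where
  open ≡-Reasoning
  regroup : ∀ a c e x → c * e + a * (c * x) ≡ c * (e + a * x)
  regroup = solve-∀

ev-⊛ : ∀ a p q → ev a (p ⊛ q) ≡ ev a p * ev a q
ev-⊛ a []      q = sym (ℤP.*-zeroˡ (ev a q))
ev-⊛ a (c ∷ p) q = begin
  ev a (scale c q ⊕ (+ 0 ∷ p ⊛ q))          ≡⟨ ev-⊕ a (scale c q) _ ⟩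
  ev a (scale c q) + (+ 0 + a * ev a (p ⊛ q)) ≡⟨ cong₂ (λ s t → s + (+ 0 + a * t)) (ev-scale a c q) (ev-⊛ a p q) ⟩
  c * ev a q + (+ 0 + a * (ev a p * ev a q))  ≡⟨ regroup a c (ev a p) (ev a q) ⟩
  (c + a * ev a p) * ev a q                   ∎
  where
  open ≡-Reasoning
  regroup : ∀ a c x y → c * y + (+ 0 + a * (x * y)) ≡ (c + a * x) * y
  regroup = solve-∀

ev-X^ : ∀ a m → ev a (X^ m) ≡ a ^ m
ev-X^ a zero    = cong (λ t → + 1 + t) (ℤP.*-zeroʳ a)
ev-X^ a (suc m) = trans (ℤP.+-identityˡ _) (cong (a *_) (ev-X^ a m))

ev-X-minus : ∀ a → ev a (X-minus a) ≡ + 0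
ev-X-minus = root
  where
  root : ∀ a → - a + a * (+ 1 + a * + 0) ≡ + 0
  root = solve-∀

module _ {n : ℕ} (a : ℤ) where

  ev-vanishing : ∀ {p} → p ≋ [] mod n → ev a p ≡ + 0 mod n
  ev-vanishing {[]}    _    = ≡-mod-refl
  ev-vanishing {c ∷ p} c∷p≋0 = begin
    c + a * ev a p ≈⟨ +-cong-mod (coeff-≡ c∷p≋0 0) (*-congˡ-mod a (ev-vanishing p≋0)) ⟩
    + 0 + a * + 0  ≡⟨ trans (ℤP.+-identityˡ _) (ℤP.*-zeroʳ a) ⟩
    + 0            ∎
    where
    open ≡-mod-Reasoning n
    p≋0 : p ≋ [] mod n
    p≋0 = coeffwise λ k → coeff-≡ c∷p≋0 (suc k)

  ev-cong : ∀ {p q} → p ≋ q mod n → ev a p ≡ ev a q mod n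
  ev-cong {p} {q} p≋q = begin
    ev a p                            ≡⟨ split (ev a p) (ev a q) ⟩
    ev a p + - + 1 * ev a q + ev a q  ≡⟨ cong (λ t → ev a p + t + ev a q) (ev-scale a (- + 1) q) ⟨
    ev a p + ev a (negP q) + ev a q   ≡⟨ cong (_+ ev a q) (ev-⊕ a p (negP q)) ⟨
    ev a (p ⊕ negP q) + ev a q        ≈⟨ +-congʳ-mod (ev a q) (ev-vanishing difference≋0) ⟩
    + 0 + ev a q                      ≡⟨ ℤP.+-identityˡ _ ⟩
    ev a q                            ∎
    where
    open ≡-mod-Reasoning n
    split : ∀ x y → x ≡ x + - + 1 * y + y
    split = solve-∀
    cancel : ∀ y → y + - + 1 * y ≡ + 0
    cancel = solve-∀
    difference≋0 : p ⊕ negP q ≋ [] mod n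
    difference≋0 = coeffwise λ k → begin
      coeff (p ⊕ negP q) k              ≡⟨ trans (coeff-⊕ p _ k) (cong (_+_ (coeff p k)) (coeff-scale (- + 1) q k)) ⟩
      coeff p k + - + 1 * coeff q k     ≈⟨ +-congʳ-mod (- + 1 * coeff q k) (coeff-≡ p≋q k) ⟩
      coeff q k + - + 1 * coeff q k     ≡⟨ cancel (coeff q k) ⟩
      + 0                               ∎

quot : ℤ → Poly → Poly
quot a []      = []
quot a (c ∷ p) = ev a p ∷ quot a p

coeff-remainder : ∀ a g k →
  coeff (quot a g ⊛ X-minus a) k + coeff (ev a g ∷ []) k ≡ coeff g k
coeff-remainder a []      zero    = refl
coeff-remainder a []      (suc k) = refl
coeff-remainder a (c ∷ p) zero    = begin
  coeff ((ev a p ∷ quot a p) ⊛ X-minus a) 0 + (c + a * ev a p)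
    ≡⟨ cong (_+ (c + a * ev a p)) (coeff-⊛-zero (ev a p ∷ quot a p) (X-minus a)) ⟩
  ev a p * - a + (c + a * ev a p)
    ≡⟨ cancel a c (ev a p) ⟩
  c ∎
  where
  open ≡-Reasoning
  cancel : ∀ a c e → e * - a + (c + a * e) ≡ c
  cancel = solve-∀
coeff-remainder a (c ∷ p) (suc k) = begin
  coeff ((e ∷ Q) ⊛ X-minus a) (suc k) + + 0
    ≡⟨ ℤP.+-identityʳ _ ⟩
  coeff ((e ∷ Q) ⊛ X-minus a) (suc k)
    ≡⟨ coeff-⊛-suc (e ∷ Q) (X-minus a) k ⟩
  e * coeff (X-minus a) (suc k) + coeff (Q ⊛ X-minus a) k
    ≡⟨ ℤP.+-comm _ (coeff (Q ⊛ X-minus a) k) ⟩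
  coeff (Q ⊛ X-minus a) k + e * coeff (X-minus a) (suc k)
    ≡⟨ cong (_+_ (coeff (Q ⊛ X-minus a) k)) (shift k) ⟩
  coeff (Q ⊛ X-minus a) k + coeff (e ∷ []) k
    ≡⟨ coeff-remainder a p k ⟩
  coeff p k ∎
  where
  open ≡-Reasoning
  e = ev a p
  Q = quot a p
  shift : ∀ k → e * coeff (X-minus a) (suc k) ≡ coeff (e ∷ []) k
  shift zero    = ℤP.*-identityʳ e
  shift (suc k) = ℤP.*-zeroʳ e

coeff-unit-combination : ∀ a g w k →
  coeff (scale (- w) (quot a g) ⊛ X-minus a ⊕ (w ∷ []) ⊛ g) k ≡ w * coeff (ev a g ∷ []) k
coeff-unit-combination a g w k = begin
  coeff (scale (- w) Q ⊛ X-minus a ⊕ (w ∷ []) ⊛ g) k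
    ≡⟨ coeff-⊕ (scale (- w) Q ⊛ X-minus a) _ k ⟩
  coeff (scale (- w) Q ⊛ X-minus a) k + coeff ((w ∷ []) ⊛ g) k
    ≡⟨ cong₂ _+_ (coeff-scale-⊛ (- w) Q (X-minus a) k) (coeff-const-⊛ w g k) ⟩
  - w * coeff (Q ⊛ X-minus a) k + w * coeff g k
    ≡⟨ cong (λ t → - w * coeff (Q ⊛ X-minus a) k + w * t) (coeff-remainder a g k) ⟨
  - w * coeff (Q ⊛ X-minus a) k + w * (coeff (Q ⊛ X-minus a) k + coeff (ev a g ∷ []) k)
    ≡⟨ collapse w _ _ ⟩
  w * coeff (ev a g ∷ []) k ∎
  where
  open ≡-Reasoning
  Q = quot a g
  collapse : ∀ w x y → - w * x + w * (x + y) ≡ w * y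
  collapse = solve-∀

module _ {n : ℕ} (a : ℤ) where

  X-minus-∣-of-root : ∀ g → + n ∣ ev a g → g ≋ quot a g ⊛ X-minus a mod n
  X-minus-∣-of-root g n∣g[a] = coeffwise λ k → begin
    coeff g k                                 ≡⟨ coeff-remainder a g k ⟨
    coeff Q k + coeff (ev a g ∷ []) k         ≈⟨ +-congˡ-mod (coeff Q k) (remainder≡0 k) ⟩
    coeff Q k + + 0                           ≡⟨ ℤP.+-identityʳ _ ⟩
    coeff Q k                                 ∎
    where
    open ≡-mod-Reasoning n
    Q : Poly
    Q = quot a g ⊛ X-minus a
    remainder≡0 : ∀ k → coeff (ev a g ∷ []) k ≡ + 0 mod n
    remainder≡0 zero    = ∣⇒≡0-mod n∣g[a]
    remainder≡0 (suc k) = ≡-mod-refl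

  one-∈-⟨X-minus,g⟩ : ∀ g w → w * ev a g ≡ + 1 mod n →
    one ≋ scale (- w) (quot a g) ⊛ X-minus a ⊕ (w ∷ []) ⊛ g mod n
  one-∈-⟨X-minus,g⟩ g w w*g[a]≡1 = coeffwise λ k → begin
    coeff one k                                                ≈⟨ constant k ⟨
    w * coeff (ev a g ∷ []) k                                  ≡⟨ coeff-unit-combination a g w k ⟨
    coeff (scale (- w) (quot a g) ⊛ X-minus a ⊕ (w ∷ []) ⊛ g) k ∎
    where
    open ≡-mod-Reasoning n
    constant : ∀ k → w * coeff (ev a g ∷ []) k ≡ coeff one k mod n
    constant zero    = w*g[a]≡1
    constant (suc k) = ≡-mod-reflexive (ℤP.*-zeroʳ w)

module _ {n : ℕ} where

  IsGcmd-sym : ∀ {g₁ g₂ h d} → IsGcmd n g₁ g₂ h d → IsGcmd n g₂ g₁ h d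
  IsGcmd-sym {g₁} {g₂} {h} (monic , (u , v , h≈) , g₁-multiple , g₂-multiple) =
    monic , (v , u , ≋⇒≈ (≋-trans (≈⇒≋ {p = h} h≈) (⊕-comm (u ⊛ g₁) (v ⊛ g₂)))) ,
    g₂-multiple , g₁-multiple

  X-minus-monic : ∀ a → MonicDeg n 1 (X-minus a)
  X-minus-monic a = divides (+ 0) refl , λ where
    (suc (suc k)) _ → divides (+ 0) refl
    (suc zero) (s≤s ())

  one-monic : MonicDeg n 0 one
  one-monic = divides (+ 0) refl , λ where
    (suc k) _ → divides (+ 0) refl

module _ {n : ℕ} (a : ℤ) where

  gcmd-X-minus-root : ∀ g → + n ∣ ev a g → IsGcmd n (X-minus a) g (X-minus a) 1
  gcmd-X-minus-root g n∣g[a] =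
    X-minus-monic a ,
    (one , [] , ≋⇒≈ (subst (λ t → X-minus a ≋ t mod n) (sym (⊕-identityʳ (one ⊛ X-minus a)))
                          (≋-sym (⊛-identityˡ (X-minus a))))) ,
    (one , ≋⇒≈ (≋-sym (⊛-identityˡ (X-minus a)))) ,
    (quot a g , ≋⇒≈ (X-minus-∣-of-root a g n∣g[a]))

  gcmd-X-minus-unit : ∀ g → Unit n (ev a g) → IsGcmd n (X-minus a) g one 0
  gcmd-X-minus-unit g (w , w*g[a]≡1) =
    one-monic ,
    (scale (- w) (quot a g) , (w ∷ []) , ≋⇒≈ (one-∈-⟨X-minus,g⟩ a g w w*g[a]≡1)) ,
    (X-minus a , ≋⇒≈ (≋-sym (⊛-identityʳ (X-minus a)))) ,
    (g , ≋⇒≈ (≋-sym (⊛-identityʳ g)))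

DegreeBelow : ℕ → ℕ → Poly → Set
DegreeBelow n k p = ∀ m → k ≤ m → coeff p m ≡ + 0 mod n

module _ {n : ℕ} where

  degreeBelow-zero⇒≋[] : ∀ {p} → DegreeBelow n 0 p → p ≋ [] mod n
  degreeBelow-zero⇒≋[] p<0 = coeffwise λ m → p<0 m z≤n

  degreeBelow-mono : ∀ {k k' p} → k ≤ k' → DegreeBelow n k p → DegreeBelow n k' p
  degreeBelow-mono k≤k' p<k m k'≤m = p<k m (ℕP.≤-trans k≤k' k'≤m)

  degreeBelow-resp : ∀ {k p q} → p ≋ q mod n → DegreeBelow n k p → DegreeBelow n k q
  degreeBelow-resp p≋q p<k m k≤m = ≡-mod-trans (≡-mod-sym (coeff-≡ p≋q m)) (p<k m k≤m)

  module _ (G : Poly) (d : ℕ) (monic : MonicDeg n d G) where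

    private
      leading : coeff G d ≡ + 1 mod n
      leading = mk≡mod (proj₁ monic)

      beyond : ∀ {m} → d < m → coeff G m ≡ + 0 mod n
      beyond d<m = ∣⇒≡0-mod (proj₂ monic _ d<m)

    degreeBelow-∷⊛-tail : ∀ {m} c p → d ≤ m →
      DegreeBelow n (suc m) ((c ∷ p) ⊛ G) → DegreeBelow n m (p ⊛ G)
    degreeBelow-∷⊛-tail c p d≤m c∷p⊛G<1+m m' m≤m' = begin
      coeff (p ⊛ G) m'                          ≡⟨ ℤP.+-identityˡ _ ⟨
      + 0 + coeff (p ⊛ G) m'                    ≡⟨ cong (_+ coeff (p ⊛ G) m') (ℤP.*-zeroʳ c) ⟨
      c * + 0 + coeff (p ⊛ G) m'                ≈⟨ +-congʳ-mod (coeff (p ⊛ G) m') (*-congˡ-mod c (≡-mod-sym G[1+m']≡0)) ⟩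
      c * coeff G (suc m') + coeff (p ⊛ G) m'   ≡⟨ coeff-⊛-suc (c ∷ p) G m' ⟨
      coeff ((c ∷ p) ⊛ G) (suc m')              ≈⟨ c∷p⊛G<1+m (suc m') (s≤s m≤m') ⟩
      + 0                                       ∎
      where
      open ≡-mod-Reasoning n
      G[1+m']≡0 : coeff G (suc m') ≡ + 0 mod n
      G[1+m']≡0 = beyond (s≤s (ℕP.≤-trans d≤m m≤m'))

    coeff-∷⊛-monic : ∀ c {p} → p ≋ [] mod n → coeff ((c ∷ p) ⊛ G) d ≡ c mod n
    coeff-∷⊛-monic c {p} p≋0 = begin
      coeff ((c ∷ p) ⊛ G) d                             ≡⟨ coeff-⊕ (scale c G) _ d ⟩
      coeff (scale c G) d + coeff (+ 0 ∷ p ⊛ G) d       ≈⟨ +-congˡ-mod (coeff (scale c G) d) (coeff-≡ shifted≋0 d) ⟩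
      coeff (scale c G) d + + 0                         ≡⟨ trans (ℤP.+-identityʳ _) (coeff-scale c G d) ⟩
      c * coeff G d                                     ≈⟨ *-congˡ-mod c leading ⟩
      c * + 1                                           ≡⟨ ℤP.*-identityʳ c ⟩
      c                                                 ∎
      where
      open ≡-mod-Reasoning n
      shifted≋0 : + 0 ∷ p ⊛ G ≋ [] mod n
      shifted≋0 = coeffwise λ where
        zero    → ≡-mod-refl
        (suc k) → coeff-≡ (⊛-congʳ G p≋0) k

    degreeBelow-⊛-monic : ∀ k p → DegreeBelow n (k ℕ.+ d) (p ⊛ G) → DegreeBelow n k p
    degreeBelow-⊛-monic k       []      _         m       _         = ≡-mod-refl
    degreeBelow-⊛-monic (suc k) (c ∷ p) c∷p⊛G<k+d (suc m) (s≤s k≤m) =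
      degreeBelow-⊛-monic k p (degreeBelow-∷⊛-tail c p (ℕP.m≤n+m d k) c∷p⊛G<k+d) m k≤m
    degreeBelow-⊛-monic zero    (c ∷ p) c∷p⊛G<d = c∷p<0
      where
      p⊛G<d : DegreeBelow n d (p ⊛ G)
      p⊛G<d = degreeBelow-∷⊛-tail c p ℕP.≤-refl (degreeBelow-mono {p = (c ∷ p) ⊛ G} (ℕP.n≤1+n d) c∷p⊛G<d)
      p≋0 : p ≋ [] mod n
      p≋0 = degreeBelow-zero⇒≋[] (degreeBelow-⊛-monic 0 p p⊛G<d)
      c∷p<0 : DegreeBelow n 0 (c ∷ p)
      c∷p<0 zero    _ = ≡-mod-trans (≡-mod-sym (coeff-∷⊛-monic c p≋0)) (c∷p⊛G<d d ℕP.≤-refl)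
      c∷p<0 (suc m) _ = coeff-≡ p≋0 m

  coeff-≡-constant-cofactor : ∀ f c G d → MonicDeg n d G → f ≋ (c ∷ []) ⊛ G mod n → coeff f d ≡ c mod n
  coeff-≡-constant-cofactor f c G d monic f≋c⊛G = begin
    coeff f d                 ≈⟨ coeff-≡ f≋c⊛G d ⟩
    coeff ((c ∷ []) ⊛ G) d    ≡⟨ coeff-const-⊛ c G d ⟩
    c * coeff G d             ≈⟨ *-congˡ-mod c (mk≡mod (proj₁ monic)) ⟩
    c * + 1                   ≡⟨ ℤP.*-identityʳ c ⟩
    c                         ∎
    where open ≡-mod-Reasoning n

module _ {n : ℕ} (a : ℤ) where

  private
    X-minus-degreeBelow-2 : DegreeBelow n 2 (X-minus a)
    X-minus-degreeBelow-2 (suc (suc m)) _ = ≡-mod-refl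
    X-minus-degreeBelow-2 (suc zero) (s≤s ())

  cofactor-of-X-minus-is-constant : ∀ p G d → MonicDeg n d G → 1 ≤ d →
    X-minus a ≋ p ⊛ G mod n → X-minus a ≋ (coeff p 0 ∷ []) ⊛ G mod n
  cofactor-of-X-minus-is-constant p G d monic 1≤d x-a≋p⊛G =
    ≋-trans x-a≋p⊛G (⊛-congʳ G p≋const)
    where
    p<1 : DegreeBelow n 1 p
    p<1 = degreeBelow-⊛-monic G d monic 1 p
      (degreeBelow-resp x-a≋p⊛G (degreeBelow-mono {p = X-minus a} (s≤s 1≤d) X-minus-degreeBelow-2))
    p≋const : p ≋ (coeff p 0 ∷ []) mod n
    p≋const = coeffwise λ where
      zero    → ≡-mod-refl
      (suc m) → p<1 (suc m) (s≤s z≤n)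

  root-of-monic-factor : 1 < n → ∀ p G d → MonicDeg n d G → 1 ≤ d →
    X-minus a ≋ p ⊛ G mod n → + n ∣ ev a G
  root-of-monic-factor 1<n p G 1 monic 1≤d x-a≋p⊛G = ≡0-mod⇒∣ (≡-mod-sym (begin
    + 0                     ≡⟨ ev-X-minus a ⟨
    ev a (X-minus a)        ≈⟨ ev-cong a x-a≋c⊛G ⟩
    ev a ((c ∷ []) ⊛ G)     ≡⟨ ev-⊛ a (c ∷ []) G ⟩
    (c + a * + 0) * ev a G  ≈⟨ *-congʳ-mod (ev a G) c+a·0≡1 ⟩
    + 1 * ev a G            ≡⟨ ℤP.*-identityˡ _ ⟩
    ev a G                  ∎))
    where
    open ≡-mod-Reasoning n
    c = coeff p 0
    x-a≋c⊛G : X-minus a ≋ (c ∷ []) ⊛ G mod n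
    x-a≋c⊛G = cofactor-of-X-minus-is-constant p G 1 monic 1≤d x-a≋p⊛G
    c+a·0≡1 : c + a * + 0 ≡ + 1 mod n
    c+a·0≡1 = ≡-mod-trans (≡-mod-reflexive (trans (cong (_+_ c) (ℤP.*-zeroʳ a)) (ℤP.+-identityʳ c)))
                          (≡-mod-sym (coeff-≡-constant-cofactor (X-minus a) c G 1 monic x-a≋c⊛G))
  root-of-monic-factor 1<n p G (suc (suc d)) monic 1≤d x-a≋p⊛G = ⊥-elim (1≢0-mod 1<n (begin
    + 1                    ≈⟨ coeff-≡ x-a≋c⊛G 1 ⟩
    coeff ((c ∷ []) ⊛ G) 1 ≡⟨ coeff-const-⊛ c G 1 ⟩
    c * coeff G 1          ≈⟨ *-congʳ-mod (coeff G 1) c≡0 ⟩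
    + 0 * coeff G 1        ≡⟨⟩
    + 0                    ∎))
    where
    open ≡-mod-Reasoning n
    c = coeff p 0
    x-a≋c⊛G : X-minus a ≋ (c ∷ []) ⊛ G mod n
    x-a≋c⊛G = cofactor-of-X-minus-is-constant p G (suc (suc d)) monic 1≤d x-a≋p⊛G
    c≡0 : c ≡ + 0 mod n
    c≡0 = ≡-mod-sym (coeff-≡-constant-cofactor (X-minus a) c G (suc (suc d)) monic x-a≋c⊛G)

  root-of-multiple : ∀ g q G → g ≋ q ⊛ G mod n → + n ∣ ev a G → + n ∣ ev a g
  root-of-multiple g q G g≋q⊛G n∣G[a] = ≡0-mod⇒∣ (begin
    ev a g               ≈⟨ ev-cong a g≋q⊛G ⟩
    ev a (q ⊛ G)         ≡⟨ ev-⊛ a q G ⟩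
    ev a q * ev a G      ≈⟨ *-congˡ-mod (ev a q) (∣⇒≡0-mod n∣G[a]) ⟩
    ev a q * + 0         ≡⟨ ℤP.*-zeroʳ (ev a q) ⟩
    + 0                  ∎)
    where open ≡-mod-Reasoning n

  ev-monic-degree-zero : ∀ G → MonicDeg n 0 G → ev a G ≡ + 1 mod n
  ev-monic-degree-zero G monic = begin
    ev a G    ≈⟨ ev-cong a G≋one ⟩
    ev a one  ≡⟨ ev-X^ a 0 ⟩
    + 1       ∎
    where
    open ≡-mod-Reasoning n
    G≋one : G ≋ one mod n
    G≋one = coeffwise λ where
      zero    → mk≡mod (proj₁ monic)
      (suc k) → ∣⇒≡0-mod (proj₂ monic (suc k) (s≤s z≤n))

  ev-prodPoly-≡1 : ∀ G r → (∀ j → j ≤ r → ev a (G j) ≡ + 1 mod n) → ev a (prodPoly G r) ≡ + 1 mod n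
  ev-prodPoly-≡1 G zero    G[a]≡1 = G[a]≡1 0 z≤n
  ev-prodPoly-≡1 G (suc r) G[a]≡1 = begin
    ev a (prodPoly G r ⊛ G (suc r))          ≡⟨ ev-⊛ a (prodPoly G r) (G (suc r)) ⟩
    ev a (prodPoly G r) * ev a (G (suc r))
      ≈⟨ *-cong-mod (ev-prodPoly-≡1 G r λ j j≤r → G[a]≡1 j (ℕP.m≤n⇒m≤1+n j≤r)) (G[a]≡1 (suc r) ℕP.≤-refl) ⟩
    + 1 * + 1                                ≡⟨⟩
    + 1                                      ∎
    where open ≡-mod-Reasoning n

  root-of-gcmd : 1 < n → ∀ {F} g G d → F ≋ X-minus a mod n → IsGcmd n F g G d → 1 ≤ d → + n ∣ ev a g
  root-of-gcmd 1<n {F} g G d F≋x-a (monic , _ , (p , F≈p⊛G) , (q , g≈q⊛G)) 1≤d =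
    root-of-multiple g q G (≈⇒≋ {p = g} g≈q⊛G)
      (root-of-monic-factor 1<n p G d monic 1≤d (≋-trans (≋-sym F≋x-a) (≈⇒≋ {p = F} F≈p⊛G)))

  root-among-gcmds : 1 < n → ∀ {F} (g G : ℕ → Poly) (dG : ℕ → ℕ) r →
    F ≋ X-minus a mod n → F ≋ prodPoly G r mod n → (∀ j → j ≤ r → IsGcmd n F (g j) (G j) (dG j)) →
    ∃ λ i → i ≤ r × + n ∣ ev a (g i)
  root-among-gcmds 1<n {F} g G dG r F≋x-a F≋∏G gcmd with ℕP.anyUpTo? (λ j → 1 ℕ.≤? dG j) (suc r)
  ... | yes (i , s≤s i≤r , 1≤dGi) = i , i≤r , root-of-gcmd 1<n (g i) (G i) (dG i) F≋x-a (gcmd i i≤r) 1≤dGi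
  ... | no no-positive-degree = ⊥-elim (1≢0-mod 1<n (begin
    + 1                   ≈⟨ ev-prodPoly-≡1 G r G[a]≡1 ⟨
    ev a (prodPoly G r)   ≈⟨ ev-cong a F≋∏G ⟨
    ev a F                ≈⟨ ev-cong a F≋x-a ⟩
    ev a (X-minus a)      ≡⟨ ev-X-minus a ⟩
    + 0                   ∎))
    where
    open ≡-mod-Reasoning n
    G[a]≡1 : ∀ j → j ≤ r → ev a (G j) ≡ + 1 mod n
    G[a]≡1 j j≤r = ev-monic-degree-zero (G j) (subst (λ d → MonicDeg n d (G j)) dGj≡0 (proj₁ (gcmd j j≤r)))
      where
      dGj≡0 : dG j ≡ 0
      dGj≡0 = ℕP.n≤0⇒n≡0 (ℕP.≮⇒≥ λ 0<dGj → no-positive-degree (j , s≤s j≤r , 0<dGj))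

sqrtStepPoly : ℕ → ℕ → Poly
sqrtStepPoly s zero    = X^ s ⊕ negP one
sqrtStepPoly s (suc j) = X^ (2 ℕ.^ j ℕ.* s) ⊕ one

sqrtStepValue : ℤ → ℕ → ℕ → ℤ
sqrtStepValue a s zero    = a ^ s - + 1
sqrtStepValue a s (suc j) = a ^ (2 ℕ.^ j ℕ.* s) + + 1

ev-sqrtStepPoly : ∀ a s j → ev a (sqrtStepPoly s j) ≡ sqrtStepValue a s j
ev-sqrtStepPoly a s zero    = begin
  ev a (X^ s ⊕ negP one)              ≡⟨ ev-⊕ a (X^ s) (negP one) ⟩
  ev a (X^ s) + ev a (negP one)       ≡⟨ cong₂ _+_ (ev-X^ a s) (ev-scale a (- + 1) one) ⟩
  a ^ s + - + 1 * ev a one            ≡⟨ cong (λ t → a ^ s + - + 1 * t) (ev-X^ a 0) ⟩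
  a ^ s - + 1                         ∎
  where open ≡-Reasoning
ev-sqrtStepPoly a s (suc j) =
  trans (ev-⊕ a (X^ (2 ℕ.^ j ℕ.* s)) one) (cong₂ _+_ (ev-X^ a (2 ℕ.^ j ℕ.* s)) (ev-X^ a 0))

^-2^suc : ∀ a s u → a ^ (2 ℕ.^ suc u ℕ.* s) ≡ a ^ (2 ℕ.^ u ℕ.* s) * a ^ (2 ℕ.^ u ℕ.* s)
^-2^suc a s u = begin
  a ^ (2 ℕ.^ suc u ℕ.* s)             ≡⟨ cong (a ^_) (ℕP.*-assoc 2 (2 ℕ.^ u) s) ⟩
  a ^ (2 ℕ.* m)                       ≡⟨ cong (λ e → a ^ (m ℕ.+ e)) (ℕP.+-identityʳ m) ⟩
  a ^ (m ℕ.+ m)                       ≡⟨ ℤP.^-distribˡ-+-* a m m ⟩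
  a ^ m * a ^ m                       ∎
  where
  open ≡-Reasoning
  m = 2 ℕ.^ u ℕ.* s

∣-square-minus-one : ∀ x → (x - + 1 ∣ x * x - + 1) × (x + + 1 ∣ x * x - + 1)
∣-square-minus-one x = divides (x + + 1) (factor₁ x) , divides (x - + 1) (factor₂ x)
  where
  factor₁ : ∀ x → x * x - + 1 ≡ (x + + 1) * (x - + 1)
  factor₁ = solve-∀
  factor₂ : ∀ x → x * x - + 1 ≡ (x - + 1) * (x + + 1)
  factor₂ = solve-∀

sqrtStepValue-∣ : ∀ a s {j u} → j ≤ u → sqrtStepValue a s j ∣ a ^ (2 ℕ.^ u ℕ.* s) - + 1
sqrtStepValue-∣ a s j≤u = go (ℕP.≤⇒≤′ j≤u)
  where
  square : ∀ u → a ^ (2 ℕ.^ suc u ℕ.* s) - + 1 ≡ a ^ (2 ℕ.^ u ℕ.* s) * a ^ (2 ℕ.^ u ℕ.* s) - + 1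
  square u = cong (_- + 1) (^-2^suc a s u)
  go : ∀ {j u} → j ℕ.≤′ u → sqrtStepValue a s j ∣ a ^ (2 ℕ.^ u ℕ.* s) - + 1
  go {zero}  ℕ.≤′-refl = ∣-reflexive (cong (λ e → a ^ e - + 1) (sym (ℕP.*-identityˡ s)))
  go {suc t} ℕ.≤′-refl =
    subst (sqrtStepValue a s (suc t) ∣_) (sym (square t))
      (proj₂ (∣-square-minus-one (a ^ (2 ℕ.^ t ℕ.* s))))
  go {j} {suc u} (ℕ.≤′-step j≤′u) =
    subst (sqrtStepValue a s j ∣_) (sym (square u))
      (∣-trans (go j≤′u) (proj₁ (∣-square-minus-one (a ^ (2 ℕ.^ u ℕ.* s)))))

module _ {n : ℕ} (odd : Odd n) (a : ℤ) (s : ℕ) where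

  sqrtStepValue-unit : ∀ {i} j → + n ∣ sqrtStepValue a s i → j ≢ i → Unit n (sqrtStepValue a s j)
  sqrtStepValue-unit {i} j n∣vᵢ j≢i with ℕP.<-cmp j i
  ... | tri≈ _ j≡i _ = ⊥-elim (j≢i j≡i)
  sqrtStepValue-unit {suc t} j n∣vᵢ j≢i | tri< (s≤s j≤t) _ _ =
    unit-∣ (sqrtStepValue-∣ a s j≤t) (unit-resp z-1≡-2 (unit-neg (two-unit odd)))
    where
    z-1≡-2 : - + 2 ≡ a ^ (2 ℕ.^ t ℕ.* s) - + 1 mod n
    z-1≡-2 = ≡-mod-sym (mk≡mod (subst (+ n ∣_) (shift (a ^ (2 ℕ.^ t ℕ.* s))) n∣vᵢ))
      where
      shift : ∀ z → z + + 1 ≡ z - + 1 - - + 2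
      shift = solve-∀
  sqrtStepValue-unit {i} (suc u) n∣vᵢ j≢i | tri> _ _ (s≤s i≤u) = unit-resp (≡-mod-sym vⱼ≡2) (two-unit odd)
    where
    vⱼ≡2 : sqrtStepValue a s (suc u) ≡ + 2 mod n
    vⱼ≡2 = +-congʳ-mod (+ 1) power≡1
      where
      power≡1 : a ^ (2 ℕ.^ u ℕ.* s) ≡ + 1 mod n
      power≡1 = mk≡mod (∣-trans n∣vᵢ (sqrtStepValue-∣ a s i≤u))

spike : {A : Set} → ℕ → A → A → ℕ → A
spike zero    x y zero    = x
spike zero    x y (suc j) = y
spike (suc i) x y zero    = y
spike (suc i) x y (suc j) = spike i x y j

module _ {A : Set} {x y : A} where

  spike-≡ : ∀ i → spike i x y i ≡ x
  spike-≡ zero    = refl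
  spike-≡ (suc i) = spike-≡ i

  spike-≢ : ∀ {i j} → j ≢ i → spike i x y j ≡ y
  spike-≢ {zero}  {zero}  j≢i = ⊥-elim (j≢i refl)
  spike-≢ {zero}  {suc j} j≢i = refl
  spike-≢ {suc i} {zero}  j≢i = refl
  spike-≢ {suc i} {suc j} j≢i = spike-≢ (λ j≡i → j≢i (cong suc j≡i))

module _ {n : ℕ} (i : ℕ) (p : Poly) where

  prodPoly-spike-below : ∀ r → r < i → prodPoly (spike i p one) r ≋ one mod n
  prodPoly-spike-below zero    (s≤s z≤n) = ≋-refl
  prodPoly-spike-below (suc r) r<i = begin
    ∏ ⊛ spike i p one (suc r) ≡⟨ cong (∏ ⊛_) (spike-≢ (ℕP.<⇒≢ r<i)) ⟩
    ∏ ⊛ one                   ≈⟨ ⊛-identityʳ ∏ ⟩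
    ∏                         ≈⟨ prodPoly-spike-below r (ℕP.<-trans (ℕP.n<1+n r) r<i) ⟩
    one                       ∎
    where
    open ≋-Reasoning n
    ∏ : Poly
    ∏ = prodPoly (spike i p one) r

  prodPoly-spike : ∀ r → i ≤ r → prodPoly (spike i p one) r ≋ p mod n
  prodPoly-spike zero    z≤n = ≋-refl
  prodPoly-spike (suc r) i≤1+r with ℕP.m≤n⇒m<n∨m≡n i≤1+r
  ... | inj₁ (s≤s i≤r) = begin
    ∏ ⊛ spike i p one (suc r) ≡⟨ cong (∏ ⊛_) (spike-≢ (ℕP.>⇒≢ (s≤s i≤r))) ⟩
    ∏ ⊛ one                   ≈⟨ ⊛-identityʳ ∏ ⟩
    ∏                         ≈⟨ prodPoly-spike r i≤r ⟩
    p                         ∎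
    where
    open ≋-Reasoning n
    ∏ : Poly
    ∏ = prodPoly (spike i p one) r
  ... | inj₂ refl = begin
    ∏ ⊛ spike i p one (suc r) ≡⟨ cong (∏ ⊛_) (spike-≡ (suc r)) ⟩
    ∏ ⊛ p                     ≈⟨ ⊛-congʳ p (prodPoly-spike-below r ℕP.≤-refl) ⟩
    one ⊛ p                   ≈⟨ ⊛-identityˡ p ⟩
    p                         ∎
    where
    open ≋-Reasoning n
    ∏ : Poly
    ∏ = prodPoly (spike i p one) r

sqrtStep-gcmds : ∀ {n} → Odd n → ∀ a s {i} → + n ∣ sqrtStepValue a s i →
  ∀ j → IsGcmd n (X-minus a) (sqrtStepPoly s j) (spike i (X-minus a) one j) (spike i 1 0 j)
sqrtStep-gcmds {n} odd a s {i} n∣vᵢ j with j ℕ.≟ i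
... | yes refl = subst₂ (IsGcmd n (X-minus a) (sqrtStepPoly s j)) (sym (spike-≡ j)) (sym (spike-≡ j))
                   (gcmd-X-minus-root a (sqrtStepPoly s j) (subst (+ n ∣_) (sym (ev-sqrtStepPoly a s j)) n∣vᵢ))
... | no j≢i   = subst₂ (IsGcmd n (X-minus a) (sqrtStepPoly s j)) (sym (spike-≢ j≢i)) (sym (spike-≢ j≢i))
                   (gcmd-X-minus-unit a (sqrtStepPoly s j)
                     (subst (Unit n) (sym (ev-sqrtStepPoly a s j)) (sqrtStepValue-unit odd a s j n∣vᵢ j≢i)))

module _ {n : ℕ} where

  F₁≋linear : ∀ {f} → deg f ≡ 1 → (fac : Factorization n f) → F fac 1 ≋ f mod n
  F₁≋linear {f} deg≡1 fac = ≋-sym (begin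
    f                   ≡⟨ fs0 fac ⟨
    fs fac 0            ≈⟨ ≈⇒≋ {p = fs fac 0} (quotF fac 1 ℕP.≤-refl (ℕP.≤-reflexive (sym deg≡1))) ⟩
    fs fac 1 ⊛ F fac 1  ≈⟨ ⊛-congʳ (F fac 1) (≈⇒≋ {p = fs fac 1} fs₁≈one) ⟩
    one ⊛ F fac 1       ≈⟨ ⊛-identityˡ (F fac 1) ⟩
    F fac 1             ∎)
    where
    open ≋-Reasoning n
    fs₁≈one : fs fac 1 ≈[ n ] one
    fs₁≈one = subst (λ d → fs fac d ≈[ n ] one) deg≡1 (lastF fac)

  frobeniusStep-linear : ∀ {f} → deg f ≡ 1 → (fac : Factorization n f) → FrobeniusStep n f fac
  frobeniusStep-linear deg≡1 fac i 2≤i i≤deg =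
    ⊥-elim (ℕP.<-irrefl refl (ℕP.≤-trans 2≤i (ℕP.≤-trans i≤deg (ℕP.≤-reflexive deg≡1))))

  factorization-X-minus : ∀ a → + n ∣ ev a (X^ (n ℕ.^ 1) ⊕ negP (X^ 1)) → Factorization n (X-minus a)
  factorization-X-minus a n∣root = record
    { F = λ _ → X-minus a ; dF = λ _ → 1 ; fs = spike 0 (X-minus a) one ; fs0 = refl
    ; gcmdF = gcmd ; quotF = cofactor ; lastF = ≋⇒≈ {p = one} ≋-refl }
    where
    gcmd : ∀ i → 1 ≤ i → i ≤ 1 →
      IsGcmd n (X^ (n ℕ.^ i) ⊕ negP (X^ 1)) (spike 0 (X-minus a) one (i ∸ 1)) (X-minus a) 1
    gcmd 1             _ _        = IsGcmd-sym {g₁ = X-minus a} (gcmd-X-minus-root a _ n∣root)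
    gcmd (suc (suc _)) _ (s≤s ())
    cofactor : ∀ i → 1 ≤ i → i ≤ 1 →
      spike 0 (X-minus a) one (i ∸ 1) ≈[ n ] (spike 0 (X-minus a) one i ⊛ X-minus a)
    cofactor 1             _ _        = ≋⇒≈ (≋-sym (⊛-identityˡ (X-minus a)))
    cofactor (suc (suc _)) _ (s≤s ())

legendre-residue : ∀ {a p} → ¬ (+ p ∣ a) →
  (∃ λ (x : Fin p) → + p ∣ (+ toℕ x) * (+ toℕ x) - a) → legendre a p ≡ + 1
legendre-residue {a} {p} p∤a square
  rewrite dec-false (+ p ∣? a) p∤a
        | dec-true (any? λ (x : Fin p) → + p ∣? (+ toℕ x) * (+ toℕ x) - a) square = refl

legendre-one : ∀ {p} → Prime p → legendre (+ 1) p ≡ + 1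
legendre-one {p} p-prime = legendre-residue (1≢0-mod 1<p ∘ mk≡mod) (fromℕ< 1<p , one-square)
  where
  1<p : 1 < p
  1<p = nonTrivial⇒n>1 p {{prime⇒nonTrivial p-prime}}
  one-square : + p ∣ (+ toℕ (fromℕ< 1<p)) * (+ toℕ (fromℕ< 1<p)) - + 1
  one-square = subst (λ m → + p ∣ (+ m) * (+ m) - + 1) (sym (toℕ-fromℕ< 1<p)) (divides (+ 0) refl)

-- disc (X-minus a) computes to + 1 and the exponent S to 0, so the step asks for (1/n) = 1.
jacobiStep-X-minus : ∀ {n} .{{_ : ℕ.NonZero n}} a (fac : Factorization n (X-minus a)) →
  JacobiStep n (X-minus a) fac
jacobiStep-X-minus {n} a fac =
  factors pf , factorsPrime pf , sym (isFactorisation pf) , legendre-one-product (factorsPrime pf)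
  where
  pf : PrimeFactorisation n
  pf = factorise n
  open PrimeFactorisation
  legendre-one-product : ∀ {ps} → All Prime ps → foldr (λ p acc → legendre (+ 1) p * acc) (+ 1) ps ≡ + 1
  legendre-one-product []           = refl
  legendre-one-product (p-prime ∷ ps) = cong₂ _*_ (legendre-one p-prime) (legendre-one-product ps)

coprime-X-minus : ∀ {n} a → gcd n ℤ.∣ + 2 * a ∣ ≡ 1 → gcd n ℤ.∣ coeff (X-minus a) 0 * disc (X-minus a) ∣ ≡ 1
coprime-X-minus {n} a gcd[n,2a]≡1 = coprime⇒gcd≡1 {n} {ℤ.∣ - a * + 1 ∣} λ {d} (d∣n , d∣∣-a*1∣) →
  gcd≡1⇒coprime {n} {ℤ.∣ + 2 * a ∣} gcd[n,2a]≡1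
    (d∣n , subst (d ℕD.∣_) (sym (ℤP.abs-* (+ 2) a))
             (ℕD.∣-trans (subst (d ℕD.∣_) ∣-a*1∣≡∣a∣ d∣∣-a*1∣) (ℕD.n∣m*n 2)))
  where
  ∣-a*1∣≡∣a∣ : ℤ.∣ - a * + 1 ∣ ≡ ℤ.∣ a ∣
  ∣-a*1∣≡∣a∣ = trans (cong ℤ.∣_∣ (ℤP.*-identityʳ (- a))) (ℤP.∣-i∣≡∣i∣ a)

fermat⇒root-of-X^n-X : ∀ {n m} a → n ≡ m ℕ.+ 1 → a ^ m ≡ + 1 mod n → + n ∣ ev a (X^ (n ℕ.^ 1) ⊕ negP (X^ 1))
fermat⇒root-of-X^n-X {n} {m} a n≡m+1 a^m≡1 = ≡0-mod⇒∣ (begin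
  ev a (X^ (n ℕ.^ 1) ⊕ negP (X^ 1))        ≡⟨ ev-⊕ a (X^ (n ℕ.^ 1)) (negP (X^ 1)) ⟩
  ev a (X^ (n ℕ.^ 1)) + ev a (negP (X^ 1)) ≡⟨ cong₂ _+_ (ev-X^ a (n ℕ.^ 1)) (ev-scale a (- + 1) (X^ 1)) ⟩
  a ^ (n ℕ.^ 1) + - + 1 * ev a (X^ 1)      ≡⟨ cong₂ (λ e t → a ^ e + - + 1 * t) n^1≡1+m (ev-X^ a 1) ⟩
  a * a ^ m + - + 1 * (a * + 1)            ≈⟨ +-congʳ-mod (- + 1 * (a * + 1)) (*-congˡ-mod a a^m≡1) ⟩
  a * + 1 + - + 1 * (a * + 1)              ≡⟨ cancel (a * + 1) ⟩
  + 0                                      ∎)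
  where
  open ≡-mod-Reasoning n
  n^1≡1+m : n ℕ.^ 1 ≡ suc m
  n^1≡1+m = trans (ℕP.*-identityʳ n) (trans n≡m+1 (ℕP.+-comm m 1))
  cancel : ∀ x → x + - + 1 * x ≡ + 0
  cancel = solve-∀

module _ {n : ℕ} (a : ℤ) (s : ℕ) {r : ℕ} where

  strongCondition⇒root :
    (+ n ∣ a ^ s - + 1) ⊎ (∃ λ t → t < r × + n ∣ a ^ (2 ℕ.^ t ℕ.* s) + + 1) →
    ∃ λ i → i ≤ r × + n ∣ sqrtStepValue a s i
  strongCondition⇒root (inj₁ n∣vₒ)             = 0 , z≤n , n∣vₒ
  strongCondition⇒root (inj₂ (t , t<r , n∣vₜ)) = suc t , t<r , n∣vₜ

  root⇒strongCondition : (∃ λ i → i ≤ r × + n ∣ sqrtStepValue a s i) →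
    (+ n ∣ a ^ s - + 1) ⊎ (∃ λ t → t < r × + n ∣ a ^ (2 ℕ.^ t ℕ.* s) + + 1)
  root⇒strongCondition (zero  , _   , n∣v₀) = inj₁ n∣v₀
  root⇒strongCondition (suc t , t<r , n∣vₜ) = inj₂ (t , t<r , n∣vₜ)

n^1∸1≡m⇒n≡m+1 : ∀ {n m} → 1 ≤ n → n ℕ.^ 1 ∸ 1 ≡ m → n ≡ m ℕ.+ 1
n^1∸1≡m⇒n≡m+1 {n} {m} 1≤n n^1∸1≡m = begin
  n                   ≡⟨ ℕP.m∸n+n≡m 1≤n ⟨
  n ∸ 1 ℕ.+ 1         ≡⟨ cong (λ k → k ∸ 1 ℕ.+ 1) (ℕP.*-identityʳ n) ⟨
  n ℕ.^ 1 ∸ 1 ℕ.+ 1   ≡⟨ cong (ℕ._+ 1) n^1∸1≡m ⟩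
  m ℕ.+ 1             ∎
  where open ≡-Reasoning

n≡m+1⇒n^1∸1≡m : ∀ {n m} → n ≡ m ℕ.+ 1 → n ℕ.^ 1 ∸ 1 ≡ m
n≡m+1⇒n^1∸1≡m {_} {m} refl = trans (cong (_∸ 1) (ℕP.*-identityʳ (m ℕ.+ 1))) (ℕP.m+n∸n≡m m 1)

strongFrobeniusPseudoprime⇒strongPseudoprime : ∀ a n →
  StrongFrobeniusPseudoprime n (X-minus a) → StrongPseudoprime a n
strongFrobeniusPseudoprime⇒strongPseudoprime a n (composite , (odd , 1<n , _) , fac , _ , _ , sqrt-step)
  with sqrt-step 1 ℕP.≤-refl ℕP.≤-refl
... | r , s , n-1≡2^r*s , odd-s , G , dG , gcmd₀ , gcmdⱼ , F₁≈∏G , _ =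
  odd , composite , r , s , n^1∸1≡m⇒n≡m+1 (ℕP.<⇒≤ 1<n) n-1≡2^r*s , odd-s , root⇒strongCondition a s root
  where
  gcmds : ∀ j → j ≤ r → IsGcmd n (F fac 1) (sqrtStepPoly s j) (G j) (dG j)
  gcmds zero    _   = gcmd₀
  gcmds (suc j) j≤r = gcmdⱼ (suc j) (s≤s z≤n) j≤r
  root : ∃ λ i → i ≤ r × + n ∣ sqrtStepValue a s i
  root with root-among-gcmds a 1<n (sqrtStepPoly s) G dG r (F₁≋linear refl fac) (≈⇒≋ {p = F fac 1} F₁≈∏G) gcmds
  ... | i , i≤r , n∣gᵢ[a] = i , i≤r , subst (+ n ∣_) (ev-sqrtStepPoly a s i) n∣gᵢ[a]

strongPseudoprime⇒strongFrobeniusPseudoprime : ∀ a n → gcd n ℤ.∣ + 2 * a ∣ ≡ 1 →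
  StrongPseudoprime a n → StrongFrobeniusPseudoprime n (X-minus a)
strongPseudoprime⇒strongFrobeniusPseudoprime a n gcd≡1 (odd , composite , r , s , n≡2^r*s+1 , odd-s , condition)
  with strongCondition⇒root a s condition
... | i , i≤r , n∣vᵢ =
  composite , (odd , 1<n , coprime-X-minus {n} a gcd≡1) , fac , frobeniusStep-linear refl fac ,
  jacobiStep-X-minus {{composite⇒nonZero composite}} a fac , sqrt-step
  where
  1<n : 1 < n
  1<n = nonTrivial⇒n>1 n {{composite⇒nonTrivial composite}}
  fermat : a ^ (2 ℕ.^ r ℕ.* s) ≡ + 1 mod n
  fermat = mk≡mod (∣-trans n∣vᵢ (sqrtStepValue-∣ a s i≤r))
  fac : Factorization n (X-minus a)
  fac = factorization-X-minus a (fermat⇒root-of-X^n-X a n≡2^r*s+1 fermat)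
  gcmds : ∀ j → IsGcmd n (X-minus a) (sqrtStepPoly s j) (spike i (X-minus a) one j) (spike i 1 0 j)
  gcmds = sqrtStep-gcmds odd a s {i} n∣vᵢ
  sqrt-step : SquareRootStep n (X-minus a) fac
  sqrt-step 1 _ _ =
    r , s , n≡m+1⇒n^1∸1≡m n≡2^r*s+1 , odd-s , spike i (X-minus a) one , spike i 1 0 ,
    gcmds 0 , (λ { (suc j) _ _ → gcmds (suc j) }) ,
    ≋⇒≈ (≋-sym (prodPoly-spike i (X-minus a) r i≤r)) , λ j _ → ℕD.1∣ _
  sqrt-step (suc (suc _)) _ (s≤s ())

theorem5p3 : (a : ℤ) (n : ℕ) → gcd n ℤ.∣ (+ 2) ℤ.* a ∣ ≡ 1 →
    StrongFrobeniusPseudoprime n (X-minus a) ⇔ StrongPseudoprime a n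
theorem5p3 a n gcd≡1 =
  mk⇔ (strongFrobeniusPseudoprime⇒strongPseudoprime a n) (strongPseudoprime⇒strongFrobeniusPseudoprime a n gcd≡1)
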